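{- Let $H_1,H_2$ be graphs with $|V(H_1)|=|V(H_2)|$ and vertex sets contained in $\{v_1,\dots,v_n\}$. For $i=1,2$ let $\mathcal C_+^{(i)}$ be a clique cover of $H_i$ and $\mathcal C_-^{(i)}\subseteq\mathcal P(H_i)\setminus\mathcal C_+^{(i)}$. Suppose there is a bijection $f:\mathcal C_+^{(1)}\to\mathcal C_+^{(2)}$ with $|f(C)|=|C|$ for all $C$, and a bijection $f':\mathcal C_-^{(1)}\to\mathcal C_-^{(2)}$ with $|f'(C)|=|C|$ for all $C$. Then $$\pi(H_1,\mathcal C_+^{(1)},\mathcal C_-^{(1)})=\pi(H_2,\mathcal C_+^{(2)},\mathcal C_-^{(2)}).$$
   Context: Random intersection graph $\mathcal G(n,m,p)$: vertex set $\{v_1,\dots,v_n\}$, attribute set $\{a_1,\dots,a_m\}$; each vertex chooses each attribute independently with probability $p$; vertices are adjacent iff they share an attribute. For a graph $H$, $\mathcal P(H)$ is the family of subsets of $V(H)$ containing both ends of at least one edge of $H$. A family $\mathcal C\subseteq\mathcal P(H)$ is a clique cover of $H$ if every edge of $H$ is contained in some $C\in\mathcal C$. An attribute builds $C\subseteq V(H)$ if all vertices of $C$ chose it and no vertex of $V(H)\setminus C$ chose it. $H$ is given by the clique cover $\mathcal C$ if every $C\in\mathcal C$ is built by some attribute and no $C\in\mathcal P(H)\setminus\mathcal C$ is built by any attribute; $\pi(H,\mathcal C)$ is its probability. $\pi(H,\mathcal C_+,\mathcal C_-)=\sum\pi(H,\mathcal C)$ over clique covers $\mathcal C$ of $H$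 with $\mathcal C_+\subseteq\mathcal C\subseteq\mathcal P(H)\setminus\mathcal C_-$.
   Formalization: The probability p takes only rational values between 0 and 1. -}

module Defs where

open import Data.Bool using (Bool; true; false; _∧_; _∨_; not; T; if_then_else_)
open import Data.Nat using (ℕ; zero; suc; _∸_)
open import Data.Fin using (Fin)
import Data.Fin as F
open import Data.Vec using (Vec; []; _∷_; lookup)
open import Data.Fin.Subset using (Subset; ∣_∣)
open import Data.Rational using (ℚ; 0ℚ; 1ℚ; _+_; _*_; _-_; _≤_)
open import Data.Product using (Σ; _×_)
open import Relation.Binary.PropositionalEquality using (_≡_)
open import Function.Bundles using (_⤖_)

-- Vertices v₁,…,vₙ are Fin n; attributes a₁,…,aₘ are Fin m.

record Graph (n : ℕ) : Set where
  field
    V       : Subset n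
    adj     : Fin n → Fin n → Bool
    adj-sym : ∀ i j → adj i j ≡ adj j i
    irrefl  : ∀ i → adj i i ≡ false
    adj-V   : ∀ i j → T (adj i j) → T (lookup V i ∧ lookup V j)
open Graph public

Family : ℕ → Set
Family n = Subset n → Bool

allFin : (n : ℕ) → (Fin n → Bool) → Bool
allFin zero    g = true
allFin (suc n) g = g F.zero ∧ allFin n (λ i → g (F.suc i))

anyFin : (n : ℕ) → (Fin n → Bool) → Bool
anyFin zero    g = false
anyFin (suc n) g = g F.zero ∨ anyFin n (λ i → g (F.suc i))

allSub : (n : ℕ) → (Subset n → Bool) → Bool
allSub zero    g = g []
allSub (suc n) g = allSub n (λ s → g (true ∷ s)) ∧ allSub n (λ s → g (false ∷ s))

_==ᵇ_ : Bool → Bool → Bool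
true  ==ᵇ b = b
false ==ᵇ b = not b

subV : ∀ {n} → Graph n → Subset n → Bool
subV {n} H C = allFin n (λ i → not (lookup C i) ∨ lookup (V H) i)

inP : ∀ {n} → Graph n → Subset n → Bool
inP {n} H C = subV H C ∧
  anyFin n (λ i → anyFin n (λ j → adj H i j ∧ lookup C i ∧ lookup C j))

IsCliqueCover : ∀ {n} → Graph n → Family n → Set
IsCliqueCover {n} H 𝒞 =
  (∀ C → T (𝒞 C) → T (inP H C)) ×
  (∀ i j → T (adj H i j) → Σ (Subset n) λ C → T (𝒞 C) × T (lookup C i) × T (lookup C j))

isCliqueCoverᵇ : ∀ {n} → Graph n → Family n → Bool
isCliqueCoverᵇ {n} H 𝒞 =
  allSub n (λ C → not (𝒞 C) ∨ inP H C) ∧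
  allFin n (λ i → allFin n (λ j → not (adj H i j) ∨
    anyFinSub (λ C → 𝒞 C ∧ lookup C i ∧ lookup C j)))
  where
  anyFinSub : (Subset n → Bool) → Bool
  anyFinSub g = not (allSub n (λ C → not (g C)))

-- Outcome of the random experiment: for each attribute, the set of
-- vertices (among v₁,…,vₙ) that chose it.
Outcome : ℕ → ℕ → Set
Outcome n m = Vec (Subset n) m

builds : ∀ {n} → Graph n → Subset n → Subset n → Bool
builds {n} H S C = allFin n (λ i →
  (not (lookup C i) ∨ lookup S i) ∧
  (not (lookup (V H) i ∧ not (lookup C i)) ∨ not (lookup S i)))

builtBySome : ∀ {n m} → Graph n → Outcome n m → Subset n → Bool
builtBySome {n} {m} H ω C = anyFin m (λ a → builds H (lookup ω a) C)

givenBy : ∀ {n m} → Graph n → Family n → Outcome n m → Bool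
givenBy {n} H 𝒞 ω = allSub n (λ C →
  (not (𝒞 C) ∨ builtBySome H ω C) ∧
  (not (inP H C ∧ not (𝒞 C)) ∨ not (builtBySome H ω C)))

pow : ℚ → ℕ → ℚ
pow x zero    = 1ℚ
pow x (suc k) = x * pow x k

sumSub : (n : ℕ) → (Subset n → ℚ) → ℚ
sumSub zero    g = g []
sumSub (suc n) g = sumSub n (λ s → g (true ∷ s)) + sumSub n (λ s → g (false ∷ s))

sumOutcome : (n m : ℕ) → (Outcome n m → ℚ) → ℚ
sumOutcome n zero    g = g []
sumOutcome n (suc m) g = sumSub n (λ S → sumOutcome n m (λ ω → g (S ∷ ω)))

sumFamily : (n : ℕ) → (Family n → ℚ) → ℚ
sumFamily zero    g = g (λ _ → false) + g (λ _ → true)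
sumFamily (suc n) g = sumFamily n (λ f₁ → sumFamily n (λ f₂ →
  g (λ { (true ∷ s) → f₁ s ; (false ∷ s) → f₂ s })))

-- probability of an outcome: each vertex picks each attribute independently w.p. p
weight : ∀ {n m} → ℚ → Outcome n m → ℚ
weight {n} p []      = 1ℚ
weight {n} p (S ∷ ω) = pow p ∣ S ∣ * pow (1ℚ - p) (n ∸ ∣ S ∣) * weight p ω

indicator : Bool → ℚ
indicator b = if b then 1ℚ else 0ℚ

π : (n m : ℕ) → ℚ → Graph n → Family n → ℚ
π n m p H 𝒞 = sumOutcome n m (λ ω → weight p ω * indicator (givenBy H 𝒞 ω))

π± : (n m : ℕ) → ℚ → Graph n → Family n → Family n → ℚ
π± n m p H 𝒞₊ 𝒞₋ = sumFamily n (λ 𝒞 →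
  indicator (isCliqueCoverᵇ H 𝒞 ∧
             allSub n (λ C → (not (𝒞₊ C) ∨ 𝒞 C) ∧ (not (𝒞₋ C) ∨ not (𝒞 C))))
  * π n m p H 𝒞)

Members : ∀ {n} → Family n → Set
Members {n} 𝒞 = Σ (Subset n) λ C → T (𝒞 C)

-- Once the outcome is fixed, the only clique cover by which H can be given is
-- the family of sets of 𝒫(H) built by some attribute.  Hence π(H, 𝒞₊, 𝒞₋) is
-- the probability that every set of 𝒞₊ and no set of 𝒞₋ is built.  An
-- attribute builds C ⊆ V(H) exactly when its trace on V(H) is C, which happens
-- with probability p^|C| (1-p)^(|V(H)|-|C|).  Conditioning on the first
-- attribute expresses the probability for m attributes through that for m-1
-- attributes, with 𝒞₊ shrunk by the set just built, using only sums over 𝒞₊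
-- and 𝒞₋ weighted by these trace probabilities.  As the weights depend only on
-- sizes, induction on m along the size-preserving bijections gives the claim.
module Submission where

open import Defs
open import Data.Bool using (Bool; true; false; _∧_; _∨_; not; T; if_then_else_)
import Data.Bool as Bool
open import Data.Bool.Properties using (T-≡; T-irrelevant)
open import Data.Empty using (⊥; ⊥-elim)
open import Data.Fin using (Fin)
open import Data.Fin.Subset using (Subset; ∣_∣; _∩_; _⊆_)
open import Data.Fin.Subset.Properties using (drop-∷-⊆; p⊆q⇒∣p∣≤∣q∣; ∣p∣≤n)
open import Data.Nat using (ℕ; zero; suc; _∸_) renaming (_≤_ to _≤ℕ_)
import Data.Nat.Properties as ℕ
open import Data.Product using (Σ; _×_; _,_; proj₁; proj₂)
open import Data.Rational using (ℚ; 0ℚ; 1ℚ; _+_; _*_; _-_; -_; _≤_)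
open import Data.Rational.Properties
  using (*-zeroˡ; *-identityˡ; *-identityʳ; *-assoc; +-identityˡ; +-identityʳ; *-distribˡ-+; neg-distrib-+;
         *-1-commutativeMonoid)
open import Data.Rational.Solver using (module +-*-Solver)
open import Data.Unit using (tt)
open import Function.Base using (_∘_)
open import Function.Bundles using (_⤖_; Bijection; Equivalence)
open import Data.Vec using ([]; _∷_; lookup; here)
open import Data.Vec.Properties using (≡-dec; []=⇒lookup; lookup⇒[]=)
open import Relation.Binary.Definitions using (DecidableEquality)
open import Relation.Binary.PropositionalEquality
open import Relation.Nullary.Decidable using (does; yes; no; dec-true; T?)
open import Algebra.Bundles using (CommutativeMonoid)
import Algebra.Properties.CommutativeSemigroup as CommutativeSemigroupProperties
open CommutativeSemigroupProperties (CommutativeMonoid.commutativeSemigroup *-1-commutativeMonoid)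
  using (x∙yz≈y∙xz; x∙yz≈z∙yx; x∙yz≈z∙xy)
open +-*-Solver
open ≡-Reasoning

∧-intro : ∀ {a b} → T a → T b → T (a ∧ b)
∧-intro {true} _ y = y

∧-elimˡ : ∀ {a b} → T (a ∧ b) → T a
∧-elimˡ {true} _ = tt

∧-elimʳ : ∀ {a b} → T (a ∧ b) → T b
∧-elimʳ {true} y = y

⇒-intro : ∀ {a b} → (T a → T b) → T (not a ∨ b)
⇒-intro {true} f = f tt
⇒-intro {false} _ = tt

⇒-elim : ∀ {a b} → T (not a ∨ b) → T a → T b
⇒-elim {true} y _ = y

∨-introˡ : ∀ {a b} → T a → T (a ∨ b)
∨-introˡ {true} _ = tt

∨-introʳ : ∀ {a b} → T b → T (a ∨ b)
∨-introʳ {true} _ = tt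
∨-introʳ {false} y = y

not-intro : ∀ {a} → (T a → ⊥) → T (not a)
not-intro {true} f = f tt
not-intro {false} _ = tt

not-elim : ∀ {a} → T (not a) → T a → ⊥
not-elim {true} ()

T-ext : ∀ {a b} → (T a → T b) → (T b → T a) → a ≡ b
T-ext {true} {true} _ _ = refl
T-ext {true} {false} f _ = ⊥-elim (f tt)
T-ext {false} {true} _ g = ⊥-elim (g tt)
T-ext {false} {false} _ _ = refl

==ᵇ-sound : ∀ {a b} → T (a ==ᵇ b) → a ≡ b
==ᵇ-sound {true} {true} _ = refl
==ᵇ-sound {false} {false} _ = refl

allSub-sound : ∀ n {g : Subset n → Bool} → T (allSub n g) → ∀ s → T (g s)
allSub-sound zero x [] = x
allSub-sound (suc n) x (true ∷ s) = allSub-sound n (∧-elimˡ x) s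
allSub-sound (suc n) x (false ∷ s) = allSub-sound n (∧-elimʳ x) s

allSub-complete : ∀ n {g : Subset n → Bool} → (∀ s → T (g s)) → T (allSub n g)
allSub-complete zero f = f []
allSub-complete (suc n) f =
  ∧-intro (allSub-complete n (λ s → f (true ∷ s))) (allSub-complete n (λ s → f (false ∷ s)))

allSub-cong : ∀ n {g h : Subset n → Bool} → (∀ s → g s ≡ h s) → allSub n g ≡ allSub n h
allSub-cong zero e = e []
allSub-cong (suc n) e =
  cong₂ _∧_ (allSub-cong n (λ s → e (true ∷ s))) (allSub-cong n (λ s → e (false ∷ s)))

allSub-∧ : ∀ n (g h : Subset n → Bool) → allSub n (λ s → g s ∧ h s) ≡ allSub n g ∧ allSub n h
allSub-∧ n g h = T-ext
  (λ x → ∧-intro (allSub-complete n (λ s → ∧-elimˡ (allSub-sound n x s)))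
                 (allSub-complete n (λ s → ∧-elimʳ (allSub-sound n x s))))
  (λ x → allSub-complete n (λ s → ∧-intro (allSub-sound n (∧-elimˡ x) s) (allSub-sound n (∧-elimʳ x) s)))

someSub-intro : ∀ n {g : Subset n → Bool} s → T (g s) → T (not (allSub n (λ t → not (g t))))
someSub-intro n s gs = not-intro (λ none → not-elim (allSub-sound n none s) gs)

allFin-sound : ∀ n {g : Fin n → Bool} → T (allFin n g) → ∀ i → T (g i)
allFin-sound (suc n) x Fin.zero = ∧-elimˡ x
allFin-sound (suc n) x (Fin.suc i) = allFin-sound n (∧-elimʳ x) i

allFin-complete : ∀ n {g : Fin n → Bool} → (∀ i → T (g i)) → T (allFin n g)
allFin-complete zero _ = tt
allFin-complete (suc n) f = ∧-intro (f Fin.zero) (allFin-complete n (λ i → f (Fin.suc i)))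

infix 4 _≟ˢ_
_≟ˢ_ : ∀ {n} → DecidableEquality (Subset n)
_≟ˢ_ = ≡-dec Bool._≟_

≟ˢ-sound : ∀ {n} {s t : Subset n} → T (does (s ≟ˢ t)) → s ≡ t
≟ˢ-sound {s = s} {t} x with s ≟ˢ t
... | yes s≡t = s≡t

≟ˢ-refl : ∀ {n} (s : Subset n) → T (does (s ≟ˢ s))
≟ˢ-refl s = subst T (sym (dec-true (s ≟ˢ s) refl)) tt

indicator-∧ : ∀ a b → indicator (a ∧ b) ≡ indicator a * indicator b
indicator-∧ true b = sym (*-identityˡ _)
indicator-∧ false b = sym (*-zeroˡ (indicator b))

indicator-*-cong : ∀ {b} {x y : ℚ} → (T b → x ≡ y) → indicator b * x ≡ indicator b * y
indicator-*-cong {true} x≡y = cong (1ℚ *_) (x≡y tt)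
indicator-*-cong {false} {x} {y} _ = trans (*-zeroˡ x) (sym (*-zeroˡ y))

indicator-true : ∀ {b} → T b → indicator b ≡ 1ℚ
indicator-true {true} _ = refl

⊆-head : ∀ {n c v} {C V : Subset n} → c ∷ C ⊆ v ∷ V → T c → T v
⊆-head {c = true} sub _ with sub here
... | here = tt

allFin⇒⊆ : ∀ {n} {C V : Subset n} → T (allFin n (λ i → not (lookup C i) ∨ lookup V i)) → C ⊆ V
allFin⇒⊆ {n} {C} {V} C⊆ᵇV {i} i∈C = lookup⇒[]= i V
  (Equivalence.to T-≡ (⇒-elim (allFin-sound n C⊆ᵇV i) (Equivalence.from T-≡ ([]=⇒lookup i∈C))))

sumSub-cong : ∀ n {g h : Subset n → ℚ} → (∀ s → g s ≡ h s) → sumSub n g ≡ sumSub n h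
sumSub-cong zero e = e []
sumSub-cong (suc n) e =
  cong₂ _+_ (sumSub-cong n (λ s → e (true ∷ s))) (sumSub-cong n (λ s → e (false ∷ s)))

sumSub-distrib-+ : ∀ n (g h : Subset n → ℚ) →
  sumSub n (λ s → g s + h s) ≡ sumSub n g + sumSub n h
sumSub-distrib-+ zero g h = refl
sumSub-distrib-+ (suc n) g h = begin
  sumSub n (λ s → g (true ∷ s) + h (true ∷ s)) + sumSub n (λ s → g (false ∷ s) + h (false ∷ s))
    ≡⟨ cong₂ _+_ (sumSub-distrib-+ n _ _) (sumSub-distrib-+ n _ _) ⟩
  (gt + ht) + (gf + hf)
    ≡⟨ solve 4 (λ a b c d → (a :+ b) :+ (c :+ d) := (a :+ c) :+ (b :+ d)) refl gt ht gf hf ⟩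
  (gt + gf) + (ht + hf) ∎
  where
  gt = sumSub n (λ s → g (true ∷ s))
  gf = sumSub n (λ s → g (false ∷ s))
  ht = sumSub n (λ s → h (true ∷ s))
  hf = sumSub n (λ s → h (false ∷ s))

sumSub-*ˡ : ∀ n c (g : Subset n → ℚ) → sumSub n (λ s → c * g s) ≡ c * sumSub n g
sumSub-*ˡ zero c g = refl
sumSub-*ˡ (suc n) c g =
  trans (cong₂ _+_ (sumSub-*ˡ n c _) (sumSub-*ˡ n c _)) (sym (*-distribˡ-+ c _ _))

sumSub-neg : ∀ n (g : Subset n → ℚ) → sumSub n (λ s → - g s) ≡ - sumSub n g
sumSub-neg zero g = refl
sumSub-neg (suc n) g =
  trans (cong₂ _+_ (sumSub-neg n _) (sumSub-neg n _))
        (sym (neg-distrib-+ (sumSub n (λ s → g (true ∷ s))) (sumSub n (λ s → g (false ∷ s)))))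

sumSub-zero : ∀ n → sumSub n (λ _ → 0ℚ) ≡ 0ℚ
sumSub-zero zero = refl
sumSub-zero (suc n) = cong₂ _+_ (sumSub-zero n) (sumSub-zero n)

sumSub-comm : ∀ n k (g : Subset n → Subset k → ℚ) →
  sumSub n (λ s → sumSub k (g s)) ≡ sumSub k (λ t → sumSub n (λ s → g s t))
sumSub-comm zero k g = refl
sumSub-comm (suc n) k g =
  trans (cong₂ _+_ (sumSub-comm n k _) (sumSub-comm n k _)) (sym (sumSub-distrib-+ k _ _))

sumSub-vanish : ∀ n (g : Subset n → ℚ) → sumSub n (λ s → 0ℚ * g s) ≡ 0ℚ
sumSub-vanish n g = trans (sumSub-cong n (λ s → *-zeroˡ (g s))) (sumSub-zero n)

sumSub-δ : ∀ n (s₀ : Subset n) (g : Subset n → ℚ) →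
  sumSub n (λ s → indicator (does (s₀ ≟ˢ s)) * g s) ≡ g s₀
sumSub-δ zero [] g = *-identityˡ (g [])
sumSub-δ (suc n) (true ∷ s₀) g =
  trans (cong₂ _+_ (sumSub-δ n s₀ (λ s → g (true ∷ s))) (sumSub-vanish n (λ s → g (false ∷ s))))
        (+-identityʳ _)
sumSub-δ (suc n) (false ∷ s₀) g =
  trans (cong₂ _+_ (sumSub-vanish n (λ s → g (true ∷ s))) (sumSub-δ n s₀ (λ s → g (false ∷ s))))
        (+-identityˡ _)

sumOutcome-cong : ∀ n m {g h : Outcome n m → ℚ} → (∀ ω → g ω ≡ h ω) →
  sumOutcome n m g ≡ sumOutcome n m h
sumOutcome-cong n zero e = e []
sumOutcome-cong n (suc m) e = sumSub-cong n (λ S → sumOutcome-cong n m (λ ω → e (S ∷ ω)))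

sumOutcome-distrib-+ : ∀ n m (g h : Outcome n m → ℚ) →
  sumOutcome n m (λ ω → g ω + h ω) ≡ sumOutcome n m g + sumOutcome n m h
sumOutcome-distrib-+ n zero g h = refl
sumOutcome-distrib-+ n (suc m) g h =
  trans (sumSub-cong n (λ S → sumOutcome-distrib-+ n m _ _)) (sumSub-distrib-+ n _ _)

sumOutcome-*ˡ : ∀ n m c (g : Outcome n m → ℚ) →
  sumOutcome n m (λ ω → c * g ω) ≡ c * sumOutcome n m g
sumOutcome-*ˡ n zero c g = refl
sumOutcome-*ˡ n (suc m) c g = trans (sumSub-cong n (λ S → sumOutcome-*ˡ n m c _)) (sumSub-*ˡ n c _)

sumFamily-cong : ∀ n {g h : Family n → ℚ} → (∀ 𝒞 → g 𝒞 ≡ h 𝒞) → sumFamily n g ≡ sumFamily n h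
sumFamily-cong zero e = cong₂ _+_ (e _) (e _)
sumFamily-cong (suc n) e = sumFamily-cong n (λ _ → sumFamily-cong n (λ _ → e _))

sumFamily-*ˡ : ∀ n c (g : Family n → ℚ) → sumFamily n (λ 𝒞 → c * g 𝒞) ≡ c * sumFamily n g
sumFamily-*ˡ zero c g = sym (*-distribˡ-+ c _ _)
sumFamily-*ˡ (suc n) c g = trans (sumFamily-cong n (λ _ → sumFamily-*ˡ n c _)) (sumFamily-*ˡ n c _)

sumFamily-sumOutcome-comm : ∀ n k m (g : Family n → Outcome k m → ℚ) →
  sumFamily n (λ 𝒞 → sumOutcome k m (g 𝒞)) ≡ sumOutcome k m (λ ω → sumFamily n (λ 𝒞 → g 𝒞 ω))
sumFamily-sumOutcome-comm zero k m g = sym (sumOutcome-distrib-+ k m _ _)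
sumFamily-sumOutcome-comm (suc n) k m g =
  trans (sumFamily-cong n (λ _ → sumFamily-sumOutcome-comm n k m _))
        (sumFamily-sumOutcome-comm n k m _)

sumFamily-δ : ∀ n (𝒦 : Family n) →
  sumFamily n (λ 𝒞 → indicator (allSub n (λ C → 𝒞 C ==ᵇ 𝒦 C))) ≡ 1ℚ
sumFamily-δ zero 𝒦 with 𝒦 []
... | true = +-identityˡ 1ℚ
... | false = +-identityʳ 1ℚ
sumFamily-δ (suc n) 𝒦 = begin
  sumFamily n (λ 𝒞₁ → sumFamily n (λ 𝒞₂ → indicator (eq₁ 𝒞₁ ∧ eq₂ 𝒞₂)))
    ≡⟨ sumFamily-cong n (λ 𝒞₁ → begin
         sumFamily n (λ 𝒞₂ → indicator (eq₁ 𝒞₁ ∧ eq₂ 𝒞₂))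
           ≡⟨ sumFamily-cong n (λ 𝒞₂ → indicator-∧ (eq₁ 𝒞₁) (eq₂ 𝒞₂)) ⟩
         sumFamily n (λ 𝒞₂ → indicator (eq₁ 𝒞₁) * indicator (eq₂ 𝒞₂))
           ≡⟨ sumFamily-*ˡ n (indicator (eq₁ 𝒞₁)) (λ 𝒞₂ → indicator (eq₂ 𝒞₂)) ⟩
         indicator (eq₁ 𝒞₁) * sumFamily n (λ 𝒞₂ → indicator (eq₂ 𝒞₂))
           ≡⟨ cong (indicator (eq₁ 𝒞₁) *_) (sumFamily-δ n (λ s → 𝒦 (false ∷ s))) ⟩
         indicator (eq₁ 𝒞₁) * 1ℚ
           ≡⟨ *-identityʳ _ ⟩
         indicator (eq₁ 𝒞₁) ∎) ⟩
  sumFamily n (λ 𝒞₁ → indicator (eq₁ 𝒞₁))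
    ≡⟨ sumFamily-δ n (λ s → 𝒦 (true ∷ s)) ⟩
  1ℚ ∎
  where
  eq₁ eq₂ : Family n → Bool
  eq₁ 𝒞₁ = allSub n (λ s → 𝒞₁ s ==ᵇ 𝒦 (true ∷ s))
  eq₂ 𝒞₂ = allSub n (λ s → 𝒞₂ s ==ᵇ 𝒦 (false ∷ s))

record FamilyBijection {n : ℕ} (A B : Family n) : Set where
  field
    to            : Subset n → Subset n
    to-∈          : ∀ {C} → T (A C) → T (B (to C))
    to-injective  : ∀ {C C′} → T (A C) → T (A C′) → to C ≡ to C′ → C ≡ C′
    to-surjective : ∀ {D} → T (B D) → Σ (Subset n) λ C → T (A C) × to C ≡ D

module _ {n : ℕ} {A B : Family n} (f : FamilyBijection A B) where
  open FamilyBijection f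

  to-≟ : ∀ {C C′} → T (A C) → T (A C′) → does (to C ≟ˢ to C′) ≡ does (C ≟ˢ C′)
  to-≟ {C} {C′} C∈A C′∈A = T-ext
    (λ e → subst (λ X → T (does (C ≟ˢ X))) (to-injective C∈A C′∈A (≟ˢ-sound e)) (≟ˢ-refl C))
    (λ e → subst (λ X → T (does (to C ≟ˢ to X))) (≟ˢ-sound {s = C} {t = C′} e) (≟ˢ-refl (to C)))

  preimageCount : ∀ {D} → T (B D) → sumSub n (λ C → indicator (A C) * indicator (does (to C ≟ˢ D))) ≡ 1ℚ
  preimageCount {D} D∈B with to-surjective D∈B
  ... | C₀ , C₀∈A , toC₀≡D = begin
    sumSub n (λ C → indicator (A C) * indicator (does (to C ≟ˢ D)))
      ≡⟨ sumSub-cong n (λ C → begin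
           indicator (A C) * indicator (does (to C ≟ˢ D))
             ≡⟨ sym (indicator-∧ (A C) _) ⟩
           indicator (A C ∧ does (to C ≟ˢ D))
             ≡⟨ cong indicator (T-ext (λ x → unique C (∧-elimˡ x) (∧-elimʳ x)) (λ x → preimage C x)) ⟩
           indicator (does (C₀ ≟ˢ C))
             ≡⟨ sym (*-identityʳ _) ⟩
           indicator (does (C₀ ≟ˢ C)) * 1ℚ ∎) ⟩
    sumSub n (λ C → indicator (does (C₀ ≟ˢ C)) * 1ℚ)
      ≡⟨ sumSub-δ n C₀ (λ _ → 1ℚ) ⟩
    1ℚ ∎
    where
    unique : ∀ C → T (A C) → T (does (to C ≟ˢ D)) → T (does (C₀ ≟ˢ C))
    unique C C∈A toC≟D =
      subst (λ X → T (does (C₀ ≟ˢ X))) (to-injective C₀∈A C∈A (trans toC₀≡D (sym (≟ˢ-sound toC≟D))))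
            (≟ˢ-refl C₀)
    preimage : ∀ C → T (does (C₀ ≟ˢ C)) → T (A C ∧ does (to C ≟ˢ D))
    preimage C C₀≟C with ≟ˢ-sound {s = C₀} {t = C} C₀≟C
    ... | refl = ∧-intro C₀∈A (subst (λ X → T (does (X ≟ˢ D))) (sym toC₀≡D) (≟ˢ-refl D))

  sumSub-reindex : ∀ (u v : Subset n → ℚ) → (∀ {C} → T (A C) → v (to C) ≡ u C) →
    sumSub n (λ C → indicator (A C) * u C) ≡ sumSub n (λ D → indicator (B D) * v D)
  sumSub-reindex u v v∘to≗u = begin
    sumSub n (λ C → indicator (A C) * u C)
      ≡⟨ sumSub-cong n (λ C → indicator-*-cong (λ C∈A →
           trans (sym (v∘to≗u C∈A))
                 (sym (trans (cong (_* v (to C)) (indicator-true (to-∈ C∈A))) (*-identityˡ (v (to C))))))) ⟩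
    sumSub n (λ C → indicator (A C) * x (to C))
      ≡⟨ sumSub-cong n (λ C → cong (indicator (A C) *_) (sym (sumSub-δ n (to C) x))) ⟩
    sumSub n (λ C → indicator (A C) * sumSub n (λ D → I C D * x D))
      ≡⟨ sumSub-cong n (λ C → sym (sumSub-*ˡ n (indicator (A C)) _)) ⟩
    sumSub n (λ C → sumSub n (λ D → indicator (A C) * (I C D * x D)))
      ≡⟨ sumSub-comm n n _ ⟩
    sumSub n (λ D → sumSub n (λ C → indicator (A C) * (I C D * x D)))
      ≡⟨ sumSub-cong n (λ D → trans (sumSub-cong n (λ C → x∙yz≈z∙xy (indicator (A C)) (I C D) (x D)))
                                   (sumSub-*ˡ n (x D) _)) ⟩
    sumSub n (λ D → x D * sumSub n (λ C → indicator (A C) * I C D))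
      ≡⟨ sumSub-cong n (λ D → trans (*-assoc (indicator (B D)) (v D) _) (indicator-*-cong (λ D∈B →
           trans (cong (v D *_) (preimageCount D∈B)) (*-identityʳ (v D))))) ⟩
    sumSub n (λ D → indicator (B D) * v D) ∎
    where
    x : Subset n → ℚ
    x D = indicator (B D) * v D
    I : Subset n → Subset n → ℚ
    I C D = indicator (does (to C ≟ˢ D))

members-≡ : ∀ {n} {A : Family n} {x y : Members A} → proj₁ x ≡ proj₁ y → x ≡ y
members-≡ {x = C , C∈A} {.C , C∈A′} refl = cong (C ,_) (T-irrelevant C∈A C∈A′)

module _ {n : ℕ} {A B : Family n} (f : Members A ⤖ Members B) where
  open Bijection f using (injective; surjective) renaming (to to f-to)

  extend : Subset n → Subset n
  extend C with T? (A C)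
  ... | yes C∈A = proj₁ (f-to (C , C∈A))
  ... | no _    = C

  extend-to : ∀ {C} (C∈A : T (A C)) → extend C ≡ proj₁ (f-to (C , C∈A))
  extend-to {C} C∈A with T? (A C)
  ... | yes C∈A′ = cong (λ x → proj₁ (f-to (C , x))) (T-irrelevant C∈A′ C∈A)
  ... | no C∉A   = ⊥-elim (C∉A C∈A)

  toFamilyBijection : FamilyBijection A B
  toFamilyBijection = record
    { to = extend
    ; to-∈ = λ {C} C∈A → subst (T ∘ B) (sym (extend-to C∈A)) (proj₂ (f-to (C , C∈A)))
    ; to-injective = λ {C} {C′} C∈A C′∈A e → cong proj₁ (injective (members-≡
        (trans (sym (extend-to C∈A)) (trans e (extend-to C′∈A)))))
    ; to-surjective = λ {D} D∈B → let ((C , C∈A) , to≡) = surjective (D , D∈B) in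
        C , C∈A , trans (extend-to C∈A) (cong proj₁ (to≡ refl))
    }

  extend-size : (∀ C → ∣ proj₁ (f-to C) ∣ ≡ ∣ proj₁ C ∣) → ∀ {C} → T (A C) → ∣ extend C ∣ ≡ ∣ C ∣
  extend-size f-size {C} C∈A = trans (cong ∣_∣ (extend-to C∈A)) (f-size (C , C∈A))

-- weight p (S ∷ ω) unfolds to binomialWeight p n ∣ S ∣ * weight p ω.
binomialWeight : ℚ → ℕ → ℕ → ℚ
binomialWeight p k c = pow p c * pow (1ℚ - p) (k ∸ c)

binomialWeight-suc-suc : ∀ p k c → binomialWeight p (suc k) (suc c) ≡ p * binomialWeight p k c
binomialWeight-suc-suc p k c = *-assoc p (pow p c) (pow (1ℚ - p) (k ∸ c))

binomialWeight-suc : ∀ p {k c} → c ≤ℕ k → binomialWeight p (suc k) c ≡ (1ℚ - p) * binomialWeight p k c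
binomialWeight-suc p {k} {c} c≤k =
  trans (cong (λ e → pow p c * pow (1ℚ - p) e) (ℕ.+-∸-assoc 1 c≤k))
        (x∙yz≈y∙xz (pow p c) (1ℚ - p) (pow (1ℚ - p) (k ∸ c)))

choice : ℚ → Bool → ℚ
choice p b = if b then p else 1ℚ - p

binomialWeight-∷ : ∀ p {n} b (S : Subset n) →
  binomialWeight p (suc n) ∣ b ∷ S ∣ ≡ choice p b * binomialWeight p n ∣ S ∣
binomialWeight-∷ p {n} true S = binomialWeight-suc-suc p n ∣ S ∣
binomialWeight-∷ p {n} false S = binomialWeight-suc p (∣p∣≤n S)

traceProb : ℚ → ∀ {n} → Subset n → Subset n → ℚ
traceProb p {n} V C = sumSub n (λ S → indicator (does (S ∩ V ≟ˢ C)) * binomialWeight p n ∣ S ∣)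

traceProb-head : ∀ p {n} b (V C : Subset n) →
  sumSub n (λ S → indicator (does (S ∩ V ≟ˢ C)) * binomialWeight p (suc n) ∣ b ∷ S ∣)
  ≡ choice p b * traceProb p V C
traceProb-head p {n} b V C = begin
  sumSub n (λ S → I S * binomialWeight p (suc n) ∣ b ∷ S ∣)
    ≡⟨ sumSub-cong n (λ S → cong (I S *_) (binomialWeight-∷ p b S)) ⟩
  sumSub n (λ S → I S * (choice p b * binomialWeight p n ∣ S ∣))
    ≡⟨ sumSub-cong n (λ S → x∙yz≈y∙xz (I S) (choice p b) _) ⟩
  sumSub n (λ S → choice p b * (I S * binomialWeight p n ∣ S ∣))
    ≡⟨ sumSub-*ˡ n (choice p b) _ ⟩
  choice p b * traceProb p V C ∎
  where
  I : Subset n → ℚ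
  I S = indicator (does (S ∩ V ≟ˢ C))

traceProb-binomial : ∀ p {n} (V C : Subset n) → C ⊆ V → traceProb p V C ≡ binomialWeight p (∣ V ∣) (∣ C ∣)
traceProb-binomial p {zero} [] [] _ = refl
traceProb-binomial p {suc n} (true ∷ V) (true ∷ C) C⊆V = begin
  traceProb p (true ∷ V) (true ∷ C)
    ≡⟨ cong₂ _+_ (traceProb-head p true V C)
                 (sumSub-vanish n (λ S → binomialWeight p (suc n) (∣ false ∷ S ∣))) ⟩
  p * traceProb p V C + 0ℚ
    ≡⟨ +-identityʳ _ ⟩
  p * traceProb p V C
    ≡⟨ cong (p *_) (traceProb-binomial p V C (drop-∷-⊆ C⊆V)) ⟩
  p * binomialWeight p (∣ V ∣) (∣ C ∣)
    ≡˘⟨ binomialWeight-suc-suc p (∣ V ∣) (∣ C ∣) ⟩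
  binomialWeight p (∣ true ∷ V ∣) (∣ true ∷ C ∣) ∎
traceProb-binomial p {suc n} (true ∷ V) (false ∷ C) C⊆V = begin
  traceProb p (true ∷ V) (false ∷ C)
    ≡⟨ cong₂ _+_ (sumSub-vanish n (λ S → binomialWeight p (suc n) (∣ true ∷ S ∣)))
                 (traceProb-head p false V C) ⟩
  0ℚ + (1ℚ - p) * traceProb p V C
    ≡⟨ +-identityˡ _ ⟩
  (1ℚ - p) * traceProb p V C
    ≡⟨ cong ((1ℚ - p) *_) (traceProb-binomial p V C C⊆V′) ⟩
  (1ℚ - p) * binomialWeight p (∣ V ∣) (∣ C ∣)
    ≡˘⟨ binomialWeight-suc p (p⊆q⇒∣p∣≤∣q∣ C⊆V′) ⟩
  binomialWeight p (∣ true ∷ V ∣) (∣ false ∷ C ∣) ∎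
  where C⊆V′ = drop-∷-⊆ C⊆V
traceProb-binomial p {suc n} (false ∷ V) (true ∷ C) C⊆V with C⊆V here
... | ()
traceProb-binomial p {suc n} (false ∷ V) (false ∷ C) C⊆V = begin
  traceProb p (false ∷ V) (false ∷ C)
    ≡⟨ cong₂ _+_ (traceProb-head p true V C) (traceProb-head p false V C) ⟩
  p * traceProb p V C + (1ℚ - p) * traceProb p V C
    ≡⟨ solve 2 (λ p t → p :* t :+ (con 1ℚ :- p) :* t := t) refl p (traceProb p V C) ⟩
  traceProb p V C
    ≡⟨ traceProb-binomial p V C (drop-∷-⊆ C⊆V) ⟩
  binomialWeight p (∣ false ∷ V ∣) (∣ false ∷ C ∣) ∎

traceProb-size : ∀ p {n} {V₁ V₂ C₁ C₂ : Subset n} → ∣ V₁ ∣ ≡ ∣ V₂ ∣ → ∣ C₁ ∣ ≡ ∣ C₂ ∣ →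
  C₁ ⊆ V₁ → C₂ ⊆ V₂ → traceProb p V₁ C₁ ≡ traceProb p V₂ C₂
traceProb-size p {V₁ = V₁} {V₂} {C₁} {C₂} ∣V₁∣≡∣V₂∣ ∣C₁∣≡∣C₂∣ C₁⊆V₁ C₂⊆V₂ = begin
  traceProb p V₁ C₁                  ≡⟨ traceProb-binomial p V₁ C₁ C₁⊆V₁ ⟩
  binomialWeight p (∣ V₁ ∣) (∣ C₁ ∣) ≡⟨ cong₂ (binomialWeight p) ∣V₁∣≡∣V₂∣ ∣C₁∣≡∣C₂∣ ⟩
  binomialWeight p (∣ V₂ ∣) (∣ C₂ ∣) ≡˘⟨ traceProb-binomial p V₂ C₂ C₂⊆V₂ ⟩
  traceProb p V₂ C₂                  ∎

sumSub-trace : ∀ p {n} (V : Subset n) (h : Subset n → ℚ) →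
  sumSub n (λ S → binomialWeight p n ∣ S ∣ * h (S ∩ V)) ≡ sumSub n (λ C → h C * traceProb p V C)
sumSub-trace p {n} V h = begin
  sumSub n (λ S → w S * h (S ∩ V))
    ≡⟨ sumSub-cong n (λ S → cong (w S *_) (sym (sumSub-δ n (S ∩ V) h))) ⟩
  sumSub n (λ S → w S * sumSub n (λ C → I S C * h C))
    ≡⟨ sumSub-cong n (λ S → sym (sumSub-*ˡ n (w S) _)) ⟩
  sumSub n (λ S → sumSub n (λ C → w S * (I S C * h C)))
    ≡⟨ sumSub-comm n n _ ⟩
  sumSub n (λ C → sumSub n (λ S → w S * (I S C * h C)))
    ≡⟨ sumSub-cong n (λ C → sumSub-cong n (λ S → x∙yz≈z∙yx (w S) (I S C) (h C))) ⟩
  sumSub n (λ C → sumSub n (λ S → h C * (I S C * w S)))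
    ≡⟨ sumSub-cong n (λ C → sumSub-*ˡ n (h C) _) ⟩
  sumSub n (λ C → h C * traceProb p V C) ∎
  where
  w : Subset n → ℚ
  w S = binomialWeight p n ∣ S ∣
  I : Subset n → Subset n → ℚ
  I S C = indicator (does (S ∩ V ≟ˢ C))

infix 4 _⊆ᶠ_
_⊆ᶠ_ : ∀ {n} → Family n → Family n → Set
R ⊆ᶠ P = ∀ {C} → T (R C) → T (P C)

_∖_ : ∀ {n} → Family n → Subset n → Family n
(R ∖ C₀) C = R C ∧ not (does (C₀ ≟ˢ C))

record Constraints (n : ℕ) : Set where
  field
    ground    : Subset n
    required  : Family n
    forbidden : Family n
    required⊆ground  : ∀ {C} → T (required C) → C ⊆ ground
    forbidden⊆ground : ∀ {C} → T (forbidden C) → C ⊆ ground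
    forbidden⇒¬required : ∀ {C} → T (forbidden C) → T (not (required C))

module Realisation (p : ℚ) {n : ℕ} (X : Constraints n) where
  open Constraints X

  -- An attribute chosen by the vertices in S builds C ⊆ ground iff its trace is C.
  trace : Subset n → Subset n
  trace S = S ∩ ground

  builtIn : ∀ {k} → Outcome n k → Subset n → Bool
  builtIn []      C = false
  builtIn (S ∷ ω) C = does (trace S ≟ˢ C) ∨ builtIn ω C

  avoidsForbidden : ∀ {k} → Outcome n k → Bool
  avoidsForbidden []      = true
  avoidsForbidden (S ∷ ω) = not (forbidden (trace S)) ∧ avoidsForbidden ω

  avoidsForbidden-sound : ∀ {k} (ω : Outcome n k) {C} →
    T (avoidsForbidden ω) → T (forbidden C) → T (builtIn ω C) → ⊥
  avoidsForbidden-sound (S ∷ ω) {C} ok C∈N built with trace S ≟ˢ C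
  ... | yes refl = not-elim (∧-elimˡ ok) C∈N
  ... | no _ = avoidsForbidden-sound ω (∧-elimʳ {not (forbidden (trace S))} ok) C∈N built

  avoidsForbidden-complete : ∀ {k} (ω : Outcome n k) →
    (∀ {C} → T (forbidden C) → T (builtIn ω C) → ⊥) → T (avoidsForbidden ω)
  avoidsForbidden-complete [] _ = tt
  avoidsForbidden-complete (S ∷ ω) h =
    ∧-intro (not-intro (λ trace∈N → h trace∈N (∨-introˡ (≟ˢ-refl (trace S)))))
            (avoidsForbidden-complete ω (λ {C} C∈N built → h C∈N (∨-introʳ {does (trace S ≟ˢ C)} built)))

  realises : ∀ {k} → Family n → Outcome n k → Bool
  realises R ω = allSub n (λ C → not (R C) ∨ builtIn ω C) ∧ avoidsForbidden ω

  prob : ℕ → Family n → ℚ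
  prob k R = sumOutcome n k (λ ω → weight p ω * indicator (realises R ω))

  prob-cong : ∀ k {R R′} → (∀ C → R C ≡ R′ C) → prob k R ≡ prob k R′
  prob-cong k R≗R′ = sumOutcome-cong n k (λ ω → cong (λ b → weight p ω * indicator (b ∧ avoidsForbidden ω))
    (allSub-cong n (λ C → cong (λ r → not r ∨ builtIn ω C) (R≗R′ C))))

  realises-∷ : ∀ {k} S (ω : Outcome n k) R →
    realises R (S ∷ ω) ≡ not (forbidden (trace S)) ∧ realises (R ∖ trace S) ω
  realises-∷ S ω R = trans
    (cong (_∧ (not (forbidden (trace S)) ∧ avoidsForbidden ω))
          (allSub-cong n (λ C → ∨-curry (R C) (does (trace S ≟ˢ C)) (builtIn ω C))))
    (∧-leftSwap _ (not (forbidden (trace S))) (avoidsForbidden ω))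
    where
    ∨-curry : ∀ r e b → not r ∨ (e ∨ b) ≡ not (r ∧ not e) ∨ b
    ∨-curry true true b = refl
    ∨-curry true false b = refl
    ∨-curry false e b = refl
    ∧-leftSwap : ∀ x y z → x ∧ (y ∧ z) ≡ y ∧ (x ∧ z)
    ∧-leftSwap true y z = refl
    ∧-leftSwap false true z = refl
    ∧-leftSwap false false z = refl

  prob-suc : ∀ k R → prob (suc k) R ≡
    sumSub n (λ S → binomialWeight p n ∣ S ∣ * (indicator (not (forbidden (trace S))) * prob k (R ∖ trace S)))
  prob-suc k R = sumSub-cong n (λ S → let w = binomialWeight p n ∣ S ∣; a = not (forbidden (trace S)) in begin
    sumOutcome n k (λ ω → (w * weight p ω) * indicator (realises R (S ∷ ω)))
      ≡⟨ sumOutcome-cong n k (λ ω → cong (λ b → (w * weight p ω) * b)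
           (trans (cong indicator (realises-∷ S ω R)) (indicator-∧ a _))) ⟩
    sumOutcome n k (λ ω → (w * weight p ω) * (indicator a * indicator (realises (R ∖ trace S) ω)))
      ≡⟨ sumOutcome-cong n k (λ ω → solve 4 (λ w x i j → (w :* x) :* (i :* j) := w :* (i :* (x :* j))) refl
           w (weight p ω) (indicator a) _) ⟩
    sumOutcome n k (λ ω → w * (indicator a * (weight p ω * indicator (realises (R ∖ trace S) ω))))
      ≡⟨ sumOutcome-*ˡ n k w _ ⟩
    w * sumOutcome n k (λ ω → indicator a * (weight p ω * indicator (realises (R ∖ trace S) ω)))
      ≡⟨ cong (w *_) (sumOutcome-*ˡ n k (indicator a) _) ⟩
    w * (indicator a * prob k (R ∖ trace S)) ∎)

  -- The set C₀ built by the first attribute is forbidden, required, or neither;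
  -- in the last case removing it leaves R unchanged.
  prob-∖-split : ∀ k {R} → R ⊆ᶠ required → ∀ C₀ →
    indicator (not (forbidden C₀)) * prob k (R ∖ C₀) ≡
    prob k R - indicator (forbidden C₀) * prob k R + indicator (required C₀) * (prob k (R ∖ C₀) - prob k R)
  prob-∖-split k {R} R⊆ C₀ with forbidden C₀ in f | required C₀ in r
  ... | true  | true  = ⊥-elim (subst (T ∘ not) r (forbidden⇒¬required (subst T (sym f) tt)))
  ... | true  | false = solve 2 (λ g h → con 0ℚ :* h := g :- con 1ℚ :* g :+ con 0ℚ :* (h :- g)) refl
                          (prob k R) (prob k (R ∖ C₀))
  ... | false | true  = solve 2 (λ g h → con 1ℚ :* h := g :- con 0ℚ :* g :+ con 1ℚ :* (h :- g)) refl
                          (prob k R) (prob k (R ∖ C₀))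
  ... | false | false = trans (cong (1ℚ *_) (prob-cong k R∖C₀≗R))
                          (solve 2 (λ g h → con 1ℚ :* g := g :- con 0ℚ :* g :+ con 0ℚ :* (h :- g)) refl
                            (prob k R) (prob k (R ∖ C₀)))
    where
    R∖C₀≗R : ∀ C → (R ∖ C₀) C ≡ R C
    R∖C₀≗R C = T-ext ∧-elimˡ (λ rC → ∧-intro rC (not-intro (λ C₀≟C →
      subst T r (subst (T ∘ required) (sym (≟ˢ-sound C₀≟C)) (R⊆ rC)))))

  totalWeight : ℚ
  totalWeight = sumSub n (λ S → binomialWeight p n ∣ S ∣)

  forbiddenMass : ℚ
  forbiddenMass = sumSub n (λ C → indicator (forbidden C) * traceProb p ground C)

  requiredGain : ℕ → Family n → ℚ
  requiredGain k R =
    sumSub n (λ C → indicator (required C) * ((prob k (R ∖ C) - prob k R) * traceProb p ground C))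

  -- Only sums over required and forbidden sets occur, so that the recursion can
  -- be transported along bijections of these families.
  prob-suc-split : ∀ k {R} → R ⊆ᶠ required →
    prob (suc k) R ≡ prob k R * totalWeight - prob k R * forbiddenMass + requiredGain k R
  prob-suc-split k {R} R⊆ = begin
    prob (suc k) R
      ≡⟨ prob-suc k R ⟩
    sumSub n (λ S → w S * (indicator (not (forbidden (trace S))) * prob k (R ∖ trace S)))
      ≡⟨ sumSub-cong n (λ S → cong (w S *_) (prob-∖-split k R⊆ (trace S))) ⟩
    sumSub n (λ S → w S * (G - f (trace S) * G + g (trace S)))
      ≡⟨ sumSub-cong n (λ S → solve 4 (λ w G f g → w :* (G :- f :* G :+ g) := G :* w :- G :* (w :* f) :+ w :* g)
                                 refl (w S) G (f (trace S)) (g (trace S))) ⟩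
    sumSub n (λ S → G * w S - G * (w S * f (trace S)) + w S * g (trace S))
      ≡⟨ sumSub-distrib-+ n _ _ ⟩
    sumSub n (λ S → G * w S - G * (w S * f (trace S))) + sumSub n (λ S → w S * g (trace S))
      ≡⟨ cong (_+ sumSub n (λ S → w S * g (trace S))) (trans (sumSub-distrib-+ n _ _)
           (cong₂ _+_ (sumSub-*ˡ n G w) (trans (sumSub-neg n _) (cong -_ (sumSub-*ˡ n G _))))) ⟩
    G * totalWeight - G * sumSub n (λ S → w S * f (trace S)) + sumSub n (λ S → w S * g (trace S))
      ≡⟨ cong₂ (λ x y → G * totalWeight - G * x + y) (sumSub-trace p ground f) (sumSub-trace p ground g) ⟩
    G * totalWeight - G * forbiddenMass + sumSub n (λ C → g C * traceProb p ground C)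
      ≡⟨ cong (G * totalWeight - G * forbiddenMass +_)
           (sumSub-cong n (λ C → *-assoc (indicator (required C)) _ (traceProb p ground C))) ⟩
    G * totalWeight - G * forbiddenMass + requiredGain k R ∎
    where
    G : ℚ
    G = prob k R
    w f g : Subset n → ℚ
    w S = binomialWeight p n ∣ S ∣
    f C = indicator (forbidden C)
    g C = indicator (required C) * (prob k (R ∖ C) - G)

module Comparison (p : ℚ) {n : ℕ} (X₁ X₂ : Constraints n)
  (∣ground∣ : ∣ Constraints.ground X₁ ∣ ≡ ∣ Constraints.ground X₂ ∣)
  (f : FamilyBijection (Constraints.required X₁) (Constraints.required X₂))
  (f-size : ∀ {C} → T (Constraints.required X₁ C) → ∣ FamilyBijection.to f C ∣ ≡ ∣ C ∣)
  (g : FamilyBijection (Constraints.forbidden X₁) (Constraints.forbidden X₂))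
  (g-size : ∀ {C} → T (Constraints.forbidden X₁ C) → ∣ FamilyBijection.to g C ∣ ≡ ∣ C ∣)
  where
  open Constraints
  open FamilyBijection
  module ℛ₁ = Realisation p X₁
  module ℛ₂ = Realisation p X₂

  record Matched (R₁ R₂ : Family n) : Set where
    field
      R₁⊆ : R₁ ⊆ᶠ required X₁
      R₂⊆ : R₂ ⊆ᶠ required X₂
      agree : ∀ {C} → T (required X₁ C) → R₁ C ≡ R₂ (to f C)
  open Matched

  matched-∖ : ∀ {R₁ R₂ C₀} → Matched R₁ R₂ → T (required X₁ C₀) →
              Matched (R₁ ∖ C₀) (R₂ ∖ to f C₀)
  matched-∖ m C₀∈P = record
    { R₁⊆ = λ x → R₁⊆ m (∧-elimˡ x)
    ; R₂⊆ = λ x → R₂⊆ m (∧-elimˡ x)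
    ; agree = λ C∈P → cong₂ (λ r e → r ∧ not e) (agree m C∈P) (sym (to-≟ f C₀∈P C∈P))
    }

  realises-[] : ∀ {R₁ R₂} → Matched R₁ R₂ → ℛ₁.realises R₁ [] ≡ ℛ₂.realises R₂ []
  realises-[] {R₁} {R₂} m = cong (_∧ true) (T-ext
    (λ none₁ → allSub-complete n (λ D → ⇒-intro (λ D∈R₂ →
      let (C , C∈P , toC≡D) = to-surjective f (R₂⊆ m D∈R₂) in
      ⇒-elim (allSub-sound n none₁ C) (subst T (sym (agree m C∈P)) (subst (T ∘ R₂) (sym toC≡D) D∈R₂)))))
    (λ none₂ → allSub-complete n (λ C → ⇒-intro (λ C∈R₁ →
      ⇒-elim (allSub-sound n none₂ (to f C)) (subst T (agree m (R₁⊆ m C∈R₁)) C∈R₁)))))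

  traceProb-along-f : ∀ {C} → T (required X₁ C) → traceProb p (ground X₂) (to f C) ≡ traceProb p (ground X₁) C
  traceProb-along-f C∈P = traceProb-size p (sym ∣ground∣) (f-size C∈P)
    (required⊆ground X₂ (to-∈ f C∈P)) (required⊆ground X₁ C∈P)

  forbiddenMass-equal : ℛ₁.forbiddenMass ≡ ℛ₂.forbiddenMass
  forbiddenMass-equal = sumSub-reindex g _ _ (λ C∈N → traceProb-size p (sym ∣ground∣) (g-size C∈N)
    (forbidden⊆ground X₂ (to-∈ g C∈N)) (forbidden⊆ground X₁ C∈N))

  prob-matched : ∀ k {R₁ R₂} → Matched R₁ R₂ → ℛ₁.prob k R₁ ≡ ℛ₂.prob k R₂
  prob-matched zero m = cong (λ b → 1ℚ * indicator b) (realises-[] m)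
  prob-matched (suc k) {R₁} {R₂} m = begin
    ℛ₁.prob (suc k) R₁
      ≡⟨ ℛ₁.prob-suc-split k (R₁⊆ m) ⟩
    ℛ₁.prob k R₁ * ℛ₁.totalWeight - ℛ₁.prob k R₁ * ℛ₁.forbiddenMass + ℛ₁.requiredGain k R₁
      ≡⟨ cong₂ _+_ (cong₂ (λ G F → G * ℛ₁.totalWeight - G * F) (prob-matched k m) forbiddenMass-equal)
                   requiredGain-equal ⟩
    ℛ₂.prob k R₂ * ℛ₂.totalWeight - ℛ₂.prob k R₂ * ℛ₂.forbiddenMass + ℛ₂.requiredGain k R₂
      ≡˘⟨ ℛ₂.prob-suc-split k (R₂⊆ m) ⟩
    ℛ₂.prob (suc k) R₂ ∎
    where
    requiredGain-equal : ℛ₁.requiredGain k R₁ ≡ ℛ₂.requiredGain k R₂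
    requiredGain-equal = sumSub-reindex f _ _ (λ C∈P →
      cong₂ _*_ (cong₂ _-_ (sym (prob-matched k (matched-∖ m C∈P))) (sym (prob-matched k m)))
                (traceProb-along-f C∈P))

  prob-required : ∀ k → ℛ₁.prob k (required X₁) ≡ ℛ₂.prob k (required X₂)
  prob-required k = prob-matched k record
    { R₁⊆ = λ x → x
    ; R₂⊆ = λ x → x
    ; agree = λ C∈P → T-ext (λ _ → to-∈ f C∈P) (λ _ → C∈P)
    }

-- The left-hand side is builds H S C with V H generalised to V.
builds-≟ : ∀ {n} (V S C : Subset n) → C ⊆ V →
  allFin n (λ i → (not (lookup C i) ∨ lookup S i) ∧ (not (lookup V i ∧ not (lookup C i)) ∨ not (lookup S i)))
  ≡ does (S ∩ V ≟ˢ C)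
builds-≟ [] [] [] _ = refl
builds-≟ (v ∷ V) (s ∷ S) (c ∷ C) C⊆V =
  cong₂ _∧_ (head v s c (⊆-head C⊆V)) (builds-≟ V S C (drop-∷-⊆ C⊆V))
  where
  head : ∀ v s c → (T c → T v) → (not c ∨ s) ∧ (not (v ∧ not c) ∨ not s) ≡ does (s ∧ v Bool.≟ c)
  head true  true  true  _ = refl
  head true  false true  _ = refl
  head false _     true  c⇒v = ⊥-elim (c⇒v tt)
  head true  true  false _ = refl
  head true  false false _ = refl
  head false true  false _ = refl
  head false false false _ = refl

module CliqueCoverModel (n m : ℕ) (p : ℚ) (H : Graph n) (P N : Family n)
  (P-cover : IsCliqueCover H P) (N⊆ : ∀ C → T (N C) → T (inP H C ∧ not (P C))) where

  inP⇒⊆ : ∀ {C} → T (inP H C) → C ⊆ V H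
  inP⇒⊆ C∈𝒫 = allFin⇒⊆ (∧-elimˡ C∈𝒫)

  constraints : Constraints n
  constraints = record
    { ground = V H
    ; required = P
    ; forbidden = N
    ; required⊆ground = λ {C} C∈P → inP⇒⊆ (proj₁ P-cover C C∈P)
    ; forbidden⊆ground = λ {C} C∈N → inP⇒⊆ (∧-elimˡ (N⊆ C C∈N))
    ; forbidden⇒¬required = λ {C} C∈N → ∧-elimʳ {inP H C} (N⊆ C C∈N)
    }

  open Realisation p constraints public

  builtBySome≡builtIn : ∀ {k} (ω : Outcome n k) {C} → C ⊆ V H → builtBySome H ω C ≡ builtIn ω C
  builtBySome≡builtIn [] _ = refl
  builtBySome≡builtIn (S ∷ ω) {C} C⊆V = cong₂ _∨_ (builds-≟ (V H) S C C⊆V) (builtBySome≡builtIn ω C⊆V)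

  builtFamily : Outcome n m → Family n
  builtFamily ω C = inP H C ∧ builtBySome H ω C

  admissible : Family n → Bool
  admissible 𝒞 = isCliqueCoverᵇ H 𝒞 ∧ allSub n (λ C → (not (P C) ∨ 𝒞 C) ∧ (not (N C) ∨ not (𝒞 C)))

  admissible⇒⊆𝒫 : ∀ 𝒞 → T (admissible 𝒞) → T (allSub n (λ C → not (𝒞 C) ∨ inP H C))
  admissible⇒⊆𝒫 𝒞 adm = ∧-elimˡ (∧-elimˡ {isCliqueCoverᵇ H 𝒞} adm)

  equalsBuilt : Family n → Outcome n m → Bool
  equalsBuilt 𝒞 ω = allSub n (λ C → 𝒞 C ==ᵇ builtFamily ω C)

  givenBy≡builtFamily : ∀ 𝒞 ω →
    givenBy H 𝒞 ω ∧ allSub n (λ C → not (𝒞 C) ∨ inP H C) ≡ equalsBuilt 𝒞 ω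
  givenBy≡builtFamily 𝒞 ω =
    trans (sym (allSub-∧ n _ _)) (allSub-cong n (λ C → pointwise (𝒞 C) (inP H C) (builtBySome H ω C)))
    where
    pointwise : ∀ c i b → ((not c ∨ b) ∧ (not (i ∧ not c) ∨ not b)) ∧ (not c ∨ i) ≡ c ==ᵇ (i ∧ b)
    pointwise true  true  true  = refl
    pointwise true  true  false = refl
    pointwise true  false true  = refl
    pointwise true  false false = refl
    pointwise false true  true  = refl
    pointwise false true  false = refl
    pointwise false false true  = refl
    pointwise false false false = refl

  module _ {𝒞 : Family n} {ω : Outcome n m} (𝒞≗built : ∀ C → 𝒞 C ≡ builtFamily ω C) where

    member⇒builtIn : ∀ {C} → T (𝒞 C) → T (builtIn ω C)
    member⇒builtIn {C} C∈𝒞 = subst T (builtBySome≡builtIn ω (inP⇒⊆ (∧-elimˡ C∈K))) (∧-elimʳ C∈K)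
      where C∈K = subst T (𝒞≗built C) C∈𝒞

    builtIn⇒member : ∀ {C} → T (inP H C) → T (builtIn ω C) → T (𝒞 C)
    builtIn⇒member {C} C∈𝒫 built =
      subst T (sym (𝒞≗built C)) (∧-intro C∈𝒫 (subst T (sym (builtBySome≡builtIn ω (inP⇒⊆ C∈𝒫))) built))

    admissible⇒realises : T (admissible 𝒞) → T (realises P ω)
    admissible⇒realises adm = ∧-intro
      (allSub-complete n (λ C → ⇒-intro (λ C∈P → member⇒builtIn (⇒-elim (∧-elimˡ (conditions C)) C∈P))))
      (avoidsForbidden-complete ω (λ {C} C∈N built →
        not-elim (⇒-elim (∧-elimʳ (conditions C)) C∈N) (builtIn⇒member (∧-elimˡ (N⊆ C C∈N)) built)))
      where
      conditions = allSub-sound n (∧-elimʳ {isCliqueCoverᵇ H 𝒞} adm)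

    realises⇒admissible : T (realises P ω) → T (admissible 𝒞)
    realises⇒admissible r = ∧-intro (∧-intro ⊆𝒫 coversEdges) (allSub-complete n (λ C →
      ∧-intro (⇒-intro P⇒𝒞) (⇒-intro (λ C∈N → not-intro (λ C∈𝒞 →
        avoidsForbidden-sound ω avoids C∈N (member⇒builtIn C∈𝒞))))))
      where
      avoids = ∧-elimʳ {allSub n (λ C → not (P C) ∨ builtIn ω C)} r
      P⇒𝒞 : ∀ {C} → T (P C) → T (𝒞 C)
      P⇒𝒞 {C} C∈P = builtIn⇒member (proj₁ P-cover C C∈P) (⇒-elim (allSub-sound n (∧-elimˡ r) C) C∈P)
      ⊆𝒫 = allSub-complete n (λ C → ⇒-intro (λ C∈𝒞 → ∧-elimˡ (subst T (𝒞≗built C) C∈𝒞)))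
      coversEdges = allFin-complete n (λ i → allFin-complete n (λ j → ⇒-intro (λ i~j →
        let (C , C∈P , i∈C , j∈C) = proj₂ P-cover i j i~j in
        someSub-intro n C (∧-intro (P⇒𝒞 C∈P) (∧-intro i∈C j∈C)))))

  admissible∧givenBy : ∀ 𝒞 ω → admissible 𝒞 ∧ givenBy H 𝒞 ω ≡ realises P ω ∧ equalsBuilt 𝒞 ω
  admissible∧givenBy 𝒞 ω = T-ext forward backward
    where
    pointwise : T (equalsBuilt 𝒞 ω) → ∀ C → 𝒞 C ≡ builtFamily ω C
    pointwise e C = ==ᵇ-sound (allSub-sound n e C)

    forward : T (admissible 𝒞 ∧ givenBy H 𝒞 ω) → T (realises P ω ∧ equalsBuilt 𝒞 ω)
    forward x = ∧-intro (admissible⇒realises {𝒞} {ω} (pointwise e) adm) e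
      where
      adm = ∧-elimˡ {admissible 𝒞} x
      e = subst T (givenBy≡builtFamily 𝒞 ω) (∧-intro (∧-elimʳ {admissible 𝒞} x) (admissible⇒⊆𝒫 𝒞 adm))

    backward : T (realises P ω ∧ equalsBuilt 𝒞 ω) → T (admissible 𝒞 ∧ givenBy H 𝒞 ω)
    backward y = ∧-intro (realises⇒admissible {𝒞} {ω} (pointwise e) (∧-elimˡ {realises P ω} y))
                         (∧-elimˡ {givenBy H 𝒞 ω} (subst T (sym (givenBy≡builtFamily 𝒞 ω)) e))
      where e = ∧-elimʳ {realises P ω} y

  π±≡prob : π± n m p H P N ≡ prob m P
  π±≡prob = begin
    sumFamily n (λ 𝒞 → indicator (admissible 𝒞) * π n m p H 𝒞)
      ≡⟨ sumFamily-cong n (λ 𝒞 → sym (sumOutcome-*ˡ n m (indicator (admissible 𝒞)) _)) ⟩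
    sumFamily n (λ 𝒞 → sumOutcome n m (λ ω → indicator (admissible 𝒞) * (weight p ω * given 𝒞 ω)))
      ≡⟨ sumFamily-sumOutcome-comm n n m _ ⟩
    sumOutcome n m (λ ω → sumFamily n (λ 𝒞 → indicator (admissible 𝒞) * (weight p ω * given 𝒞 ω)))
      ≡⟨ sumOutcome-cong n m (λ ω → sumFamily-cong n (λ 𝒞 → begin
           indicator (admissible 𝒞) * (weight p ω * given 𝒞 ω)
             ≡⟨ x∙yz≈y∙xz (indicator (admissible 𝒞)) (weight p ω) (given 𝒞 ω) ⟩
           weight p ω * (indicator (admissible 𝒞) * given 𝒞 ω)
             ≡⟨ cong (weight p ω *_) (begin
                  indicator (admissible 𝒞) * given 𝒞 ω
                    ≡⟨ sym (indicator-∧ (admissible 𝒞) (givenBy H 𝒞 ω)) ⟩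
                  indicator (admissible 𝒞 ∧ givenBy H 𝒞 ω)
                    ≡⟨ cong indicator (admissible∧givenBy 𝒞 ω) ⟩
                  indicator (realises P ω ∧ equalsBuilt 𝒞 ω)
                    ≡⟨ indicator-∧ (realises P ω) (equalsBuilt 𝒞 ω) ⟩
                  indicator (realises P ω) * indicator (equalsBuilt 𝒞 ω) ∎) ⟩
           weight p ω * (indicator (realises P ω) * indicator (equalsBuilt 𝒞 ω))
             ≡⟨ sym (*-assoc (weight p ω) _ _) ⟩
           (weight p ω * indicator (realises P ω)) * indicator (equalsBuilt 𝒞 ω) ∎)) ⟩
    sumOutcome n m (λ ω → sumFamily n (λ 𝒞 → (weight p ω * indicator (realises P ω)) * indicator (equalsBuilt 𝒞 ω)))
      ≡⟨ sumOutcome-cong n m (λ ω → begin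
           sumFamily n (λ 𝒞 → (weight p ω * indicator (realises P ω)) * indicator (equalsBuilt 𝒞 ω))
             ≡⟨ sumFamily-*ˡ n (weight p ω * indicator (realises P ω)) _ ⟩
           (weight p ω * indicator (realises P ω)) * sumFamily n (λ 𝒞 → indicator (equalsBuilt 𝒞 ω))
             ≡⟨ cong ((weight p ω * indicator (realises P ω)) *_) (sumFamily-δ n (builtFamily ω)) ⟩
           (weight p ω * indicator (realises P ω)) * 1ℚ
             ≡⟨ *-identityʳ _ ⟩
           weight p ω * indicator (realises P ω) ∎) ⟩
    prob m P ∎
    where
    given : Family n → Outcome n m → ℚ
    given 𝒞 ω = indicator (givenBy H 𝒞 ω)

-- The identity is polynomial in p.
lemma5p2 : (n m : ℕ) (p : ℚ) → 0ℚ ≤ p → p ≤ 1ℚ →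
    (H₁ H₂ : Graph n) → ∣ V H₁ ∣ ≡ ∣ V H₂ ∣ →
    (𝒞₊¹ 𝒞₋¹ 𝒞₊² 𝒞₋² : Family n) →
    IsCliqueCover H₁ 𝒞₊¹ → IsCliqueCover H₂ 𝒞₊² →
    (∀ C → T (𝒞₋¹ C) → T (inP H₁ C ∧ not (𝒞₊¹ C))) →
    (∀ C → T (𝒞₋² C) → T (inP H₂ C ∧ not (𝒞₊² C))) →
    (Σ (Members 𝒞₊¹ ⤖ Members 𝒞₊²) λ f →
       ∀ C → ∣ proj₁ (Bijection.to f C) ∣ ≡ ∣ proj₁ C ∣) →
    (Σ (Members 𝒞₋¹ ⤖ Members 𝒞₋²) λ f′ →
       ∀ C → ∣ proj₁ (Bijection.to f′ C) ∣ ≡ ∣ proj₁ C ∣) →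
    π± n m p H₁ 𝒞₊¹ 𝒞₋¹ ≡ π± n m p H₂ 𝒞₊² 𝒞₋²
lemma5p2 n m p _ _ H₁ H₂ ∣V₁∣≡∣V₂∣ P₁ N₁ P₂ N₂ cover₁ cover₂ N₁⊆ N₂⊆ (f , f-size) (f′ , f′-size) =
  begin
    π± n m p H₁ P₁ N₁ ≡⟨ G₁.π±≡prob ⟩
    G₁.prob m P₁      ≡⟨ Comparison.prob-required p G₁.constraints G₂.constraints ∣V₁∣≡∣V₂∣
                           (toFamilyBijection f) (extend-size f f-size)
                           (toFamilyBijection f′) (extend-size f′ f′-size) m ⟩
    G₂.prob m P₂      ≡˘⟨ G₂.π±≡prob ⟩
    π± n m p H₂ P₂ N₂ ∎
  where
  module G₁ = CliqueCoverModel n m p H₁ P₁ N₁ cover₁ N₁⊆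
  module G₂ = CliqueCoverModel n m p H₂ P₂ N₂ cover₂ N₂⊆
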